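{- Let $d\geq 1$, $r\geq 1$ and $i\in\{1,2,\ldots,d\}$ be integers. Then the family of translated hypersimplices \[\mathcal H_{r,d,i}=\bigcup_{j=1}^{d}\{\bm v+\Delta_{d,j}:\bm v\in\mathcal C(r-1,d+1,ir-j)\}\] is a polytopal subdivision of $r\Delta_{d,i}=\{r\bm x:\bm x\in\Delta_{d,i}\}$; that is, the union of the members of $\mathcal H_{r,d,i}$ equals $r\Delta_{d,i}$, and any two distinct members of $\mathcal H_{r,d,i}$ are non-overlapping (their relative interiors are disjoint).
   Context: For integers $d\geq 1$ and $0\le j\le d+1$, the hypersimplex $\Delta_{d,j}\subset\mathbb R^{d+1}$ is the convex hull of the characteristic vectors $\bm e_T=\sum_{t\in T}\bm e_t$ of all $j$-element subsets $T\subseteq\{1,\ldots,d+1\}$; equivalently $\Delta_{d,j}=\{\bm x\in\mathbb R^{d+1}:x_1+\cdots+x_{d+1}=j,\ 0\le x_t\le 1 \text{ for all } t\}$. For integers $m\ge 0$, $n\ge1$ and $k$, $\mathcal C(m,n,k)$ denotes the set of weak compositions of $k$ into $n$ parts with no part greater than $m$: $\mathcal C(m,n,k)=\{\bm v\in\mathbb Z_{\ge 0}^{n}: v_1+\cdots+v_n=k,\ v_t\le m \text{ for } 1\le t\le n\}$. A polytopal subdivision of a polytope $P$ is a collection of non-overlapping polytopes whose union is $P$.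
   Formalization: All points, both in the union and in the relative interiors, are taken in ℚ^(d+1) instead of ℝ^(d+1), and the relative interiors are defined using rational scalars only. -}

module Defs where

open import Data.Nat as ℕ using (ℕ; zero; suc)
open import Data.Integer as ℤ using (ℤ; +_)
open import Data.Fin using (Fin; zero; suc)
open import Data.Rational using (ℚ; _/_; 0ℚ; 1ℚ; _+_; _-_; _*_; _≤_; _<_)
open import Data.Product using (Σ; _×_; ∃)
open import Relation.Binary.PropositionalEquality using (_≡_)

-- Points of ℚ^n (coordinates indexed by Fin n; coordinate t+1 of the paper is Fin index t).
Point : ℕ → Set
Point n = Fin n → ℚ

ℕ→ℚ : ℕ → ℚ
ℕ→ℚ k = + k / 1

sumℚ : ∀ {n} → (Fin n → ℚ) → ℚ
sumℚ {zero}  x = 0ℚ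
sumℚ {suc n} x = x zero + sumℚ (λ t → x (suc t))

sumℕ : ∀ {n} → (Fin n → ℕ) → ℕ
sumℕ {zero}  v = 0
sumℕ {suc n} v = v zero ℕ.+ sumℕ (λ t → v (suc t))

-- Hypersimplex Δ_{d,j} ⊂ ℚ^{d+1}, via the description
-- {x : x_1+...+x_{d+1} = j, 0 ≤ x_t ≤ 1}  (given in the paper as equivalent).
Hypersimplex : (d j : ℕ) → Point (suc d) → Set
Hypersimplex d j x = (sumℚ x ≡ ℕ→ℚ j) × (∀ t → (0ℚ ≤ x t) × (x t ≤ 1ℚ))

Dilate : ∀ {n} → ℕ → (Point n → Set) → Point n → Set
Dilate r P x = Σ (Point _) λ y → P y × (∀ t → x t ≡ ℕ→ℚ r * y t)

Translate : ∀ {n} → (Fin n → ℕ) → (Point n → Set) → Point n → Set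
Translate v P x = Σ (Point _) λ y → P y × (∀ t → x t ≡ ℕ→ℚ (v t) + y t)

InC : (m n : ℕ) (k : ℤ) → (Fin n → ℕ) → Set
InC m n k v = (+ sumℕ v ≡ k) × (∀ t → v t ℕ.≤ m)

-- Relative interior of a convex set P (Rockafellar, Thm 6.4):
-- x ∈ relint P iff x ∈ P and for every y ∈ P there is ε > 0 with
-- x + ε (x − y) ∈ P.
RelInt : ∀ {n} → (Point n → Set) → Point n → Set
RelInt P x = P x × (∀ y → P y →
  Σ ℚ λ ε → (0ℚ < ε) × P (λ t → x t + ε * (x t - y t)))

{-# OPTIONS --safe #-}
-- Since i ≤ d, some coordinate
-- x_{t₀} is < r; round it down and round every other coordinate up (minus one), writing
-- x = v + y with v ∈ {0, ..., r-1}^{d+1}, y ∈ [0,1]^{d+1}, y_{t₀} < 1, and y_{t₁} > 0 for a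
-- coordinate t₁ ≠ t₀ with x_{t₁} > 0 (one exists because x_{t₀} < r ≤ ir). Then Σ y = ir - Σ v is
-- an integer j with 0 < j < d + 1, so x ∈ v + Δ_{d,j}. Conversely v + Δ_{d,j} ⊆ rΔ_{d,i}, since
-- 0 ≤ v_t + y_t ≤ r and Σ v + j = ir.
-- A point of the relative interior of v + Δ_{d,j} can be pushed away from the barycentre
-- v + j/(d+1)·𝟙 without leaving the polytope, which forces v_t < x_t < v_t + 1 for every t. Open
-- unit cubes at distinct lattice points are disjoint, and v determines j = ir - Σ v.
module Submission where

open import Defs

-- The rational operators are opened only inside this module: the statement of theorem1p2 at the
-- end uses the homonymous operators of ℕ and ℤ.
module _ where
  open import Level using (0ℓ)
  open import Function using (_∘_)
  open import Data.List using ([]; _∷_)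
  open import Data.Nat as ℕ using (ℕ; zero; suc)
  import Data.Nat.Properties as ℕ
  import Data.Nat.Coprimality as Coprime
  import Data.Integer as ℤ
  import Data.Integer.Properties as ℤ
  open import Data.Fin using (Fin; zero; suc)
  open import Data.Fin.Properties as Fin using (any?)
  open import Data.Product using (Σ; ∃; _×_; _,_; proj₁; proj₂; map₂)
  open import Data.Rational as ℚ
    using (ℚ; mkℚ; 0ℚ; 1ℚ; _+_; _*_; _-_; -_; 1/_; _≤_; _<_; Positive; NonNegative; *≤*; *<*; nonNegative; positive)
  open import Data.Rational.Properties
  open import Relation.Nullary using (Dec; ¬_; yes; no; contradiction; _×-dec_; ¬?)
  open import Relation.Nullary.Decidable using (dec⇒maybe)
  open import Relation.Binary.PropositionalEquality
  open import Algebra.Properties.Group +-0-group using () renaming (∙-cancelˡ to +-cancelˡ)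
  import Algebra.Properties.AbelianGroup ℤ.+-0-abelianGroup as ℤ-Group
  open import Tactic.RingSolver using (solve-∀)
  open import Tactic.RingSolver.Core.AlmostCommutativeRing
    using (AlmostCommutativeRing; fromCommutativeRing)

  ℚ-ring : AlmostCommutativeRing 0ℓ 0ℓ
  ℚ-ring = fromCommutativeRing +-*-commutativeRing (λ q → dec⇒maybe (0ℚ ≟ q))

  p≤q⇒0≤q-p : ∀ {p q} → p ≤ q → 0ℚ ≤ q - p
  p≤q⇒0≤q-p {p} {q} p≤q = subst (_≤ q - p) (+-inverseʳ p) (+-monoˡ-≤ (- p) p≤q)

  p<q⇒0<q-p : ∀ {p q} → p < q → 0ℚ < q - p
  p<q⇒0<q-p {p} {q} p<q = subst (_< q - p) (+-inverseʳ p) (+-monoˡ-< (- p) p<q)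

  p+r-p≡r : ∀ p r → p + r - p ≡ r
  p+r-p≡r = solve-∀ ℚ-ring

  q≤p+r⇒q-p≤r : ∀ {p q r} → q ≤ p + r → q - p ≤ r
  q≤p+r⇒q-p≤r {p} {q} {r} q≤p+r = subst (q - p ≤_) (p+r-p≡r p r) (+-monoˡ-≤ (- p) q≤p+r)

  q<p+r⇒q-p<r : ∀ {p q r} → q < p + r → q - p < r
  q<p+r⇒q-p<r {p} {q} {r} q<p+r = subst (q - p <_) (p+r-p≡r p r) (+-monoˡ-< (- p) q<p+r)

  +-interchange : ∀ a b c e → (a + b) + (c + e) ≡ (a + c) + (b + e)
  +-interchange = solve-∀ ℚ-ring

  p+[q-p]≡q : ∀ p q → p + (q - p) ≡ q
  p+[q-p]≡q = solve-∀ ℚ-ring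

  <⇒≱ : ∀ {p q} → p < q → ¬ q ≤ p
  <⇒≱ p<q q≤p = <-irrefl refl (<-≤-trans p<q q≤p)

  ℕ→ℚ≡mkℚ : ∀ n → ℕ→ℚ n ≡ mkℚ (ℤ.+ n) 0 (Coprime.sym (Coprime.1-coprimeTo n))
  ℕ→ℚ≡mkℚ n = normalize-coprime (Coprime.sym (Coprime.1-coprimeTo n))

  ℕ→ℚ-homo-+ : ∀ m n → ℕ→ℚ (m ℕ.+ n) ≡ ℕ→ℚ m + ℕ→ℚ n
  ℕ→ℚ-homo-+ m n rewrite ℕ→ℚ≡mkℚ m | ℕ→ℚ≡mkℚ n =
    cong (ℚ._/ 1) (sym (cong₂ ℤ._+_ (ℤ.*-identityʳ (ℤ.+ m)) (ℤ.*-identityʳ (ℤ.+ n))))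

  ℕ→ℚ-homo-* : ∀ m n → ℕ→ℚ (m ℕ.* n) ≡ ℕ→ℚ m * ℕ→ℚ n
  ℕ→ℚ-homo-* m n rewrite ℕ→ℚ≡mkℚ m | ℕ→ℚ≡mkℚ n = cong (ℚ._/ 1) (ℤ.pos-* m n)

  ℕ→ℚ-suc : ∀ n → ℕ→ℚ (suc n) ≡ ℕ→ℚ n + 1ℚ
  ℕ→ℚ-suc n = trans (cong ℕ→ℚ (ℕ.+-comm 1 n)) (ℕ→ℚ-homo-+ n 1)

  ℕ→ℚ-mono-≤ : ∀ {m n} → m ℕ.≤ n → ℕ→ℚ m ≤ ℕ→ℚ n
  ℕ→ℚ-mono-≤ {m} {n} m≤n rewrite ℕ→ℚ≡mkℚ m | ℕ→ℚ≡mkℚ n =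
    *≤* (ℤ.*-monoʳ-≤-nonNeg (ℤ.+ 1) (ℤ.+≤+ m≤n))

  ℕ→ℚ-cancel-≤ : ∀ {m n} → ℕ→ℚ m ≤ ℕ→ℚ n → m ℕ.≤ n
  ℕ→ℚ-cancel-≤ {m} {n} m≤n rewrite ℕ→ℚ≡mkℚ m | ℕ→ℚ≡mkℚ n
    with *≤* m*1≤n*1 ← m≤n rewrite ℤ.*-identityʳ (ℤ.+ m) | ℤ.*-identityʳ (ℤ.+ n) = ℤ.drop‿+≤+ m*1≤n*1

  ℕ→ℚ-mono-< : ∀ {m n} → m ℕ.< n → ℕ→ℚ m < ℕ→ℚ n
  ℕ→ℚ-mono-< {m} {n} m<n rewrite ℕ→ℚ≡mkℚ m | ℕ→ℚ≡mkℚ n =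
    *<* (ℤ.*-monoʳ-<-pos (ℤ.+ 1) (ℤ.+<+ m<n))

  ℕ→ℚ-cancel-< : ∀ {m n} → ℕ→ℚ m < ℕ→ℚ n → m ℕ.< n
  ℕ→ℚ-cancel-< {m} {n} m<n rewrite ℕ→ℚ≡mkℚ m | ℕ→ℚ≡mkℚ n
    with *<* m*1<n*1 ← m<n rewrite ℤ.*-identityʳ (ℤ.+ m) | ℤ.*-identityʳ (ℤ.+ n) = ℤ.drop‿+<+ m*1<n*1

  ℕ→ℚ-nonNeg : ∀ n → 0ℚ ≤ ℕ→ℚ n
  ℕ→ℚ-nonNeg n = ℕ→ℚ-mono-≤ {0} {n} ℕ.z≤n

  ℕ→ℚ-suc-pos : ∀ n → Positive (ℕ→ℚ (suc n))
  ℕ→ℚ-suc-pos n rewrite ℕ→ℚ≡mkℚ (suc n) = _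

  m+q≡n⇒q∈ℕ : ∀ m n {q} → ℕ→ℚ m + q ≡ ℕ→ℚ n → 0ℚ ≤ q → ∃ λ k → m ℕ.+ k ≡ n × q ≡ ℕ→ℚ k
  m+q≡n⇒q∈ℕ m n {q} m+q≡n 0≤q = n ℕ.∸ m , m+[n∸m]≡n , +-cancelˡ (ℕ→ℚ m) q (ℕ→ℚ (n ℕ.∸ m)) (begin
    ℕ→ℚ m + q                ≡⟨ m+q≡n ⟩
    ℕ→ℚ n                    ≡⟨ cong ℕ→ℚ m+[n∸m]≡n ⟨
    ℕ→ℚ (m ℕ.+ (n ℕ.∸ m))    ≡⟨ ℕ→ℚ-homo-+ m (n ℕ.∸ m) ⟩
    ℕ→ℚ m + ℕ→ℚ (n ℕ.∸ m)    ∎)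
    where
    open ≡-Reasoning
    m+[n∸m]≡n : m ℕ.+ (n ℕ.∸ m) ≡ n
    m+[n∸m]≡n = ℕ.m+[n∸m]≡n (ℕ→ℚ-cancel-≤ {m} {n} (subst₂ _≤_ (+-identityʳ (ℕ→ℚ m)) m+q≡n (+-monoʳ-≤ (ℕ→ℚ m) 0≤q)))

  +m≡+n-+k⇒m+k≡n : ∀ {m n k} → ℤ.+ m ≡ ℤ.+ n ℤ.- ℤ.+ k → m ℕ.+ k ≡ n
  +m≡+n-+k⇒m+k≡n {m} {n} {k} eq =
    ℤ.+-injective (trans (cong (ℤ._+ ℤ.+ k) eq) (ℤ-Group.//-rightDividesˡ (ℤ.+ k) (ℤ.+ n)))

  m+k≡n⇒+m≡+n-+k : ∀ {m n k} → m ℕ.+ k ≡ n → ℤ.+ m ≡ ℤ.+ n ℤ.- ℤ.+ k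
  m+k≡n⇒+m≡+n-+k {m} {n} {k} eq =
    trans (sym (ℤ-Group.//-rightDividesʳ (ℤ.+ k) (ℤ.+ m))) (cong (λ l → ℤ.+ l ℤ.- ℤ.+ k) eq)

  sumℚ-cong : ∀ {n} {x y : Point n} → (∀ t → x t ≡ y t) → sumℚ x ≡ sumℚ y
  sumℚ-cong {zero}  x≗y = refl
  sumℚ-cong {suc n} x≗y = cong₂ _+_ (x≗y zero) (sumℚ-cong (x≗y ∘ suc))

  sumℕ-cong : ∀ {n} {v w : Fin n → ℕ} → (∀ t → v t ≡ w t) → sumℕ v ≡ sumℕ w
  sumℕ-cong {zero}  v≗w = refl
  sumℕ-cong {suc n} v≗w = cong₂ ℕ._+_ (v≗w zero) (sumℕ-cong (v≗w ∘ suc))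

  sumℚ-+ : ∀ {n} (x y : Point n) → sumℚ (λ t → x t + y t) ≡ sumℚ x + sumℚ y
  sumℚ-+ {zero}  x y = refl
  sumℚ-+ {suc n} x y = trans (cong (x zero + y zero +_) (sumℚ-+ (x ∘ suc) (y ∘ suc)))
                             (+-interchange (x zero) (y zero) _ _)

  sumℚ-*ˡ : ∀ {n} (c : ℚ) (x : Point n) → sumℚ (λ t → c * x t) ≡ c * sumℚ x
  sumℚ-*ˡ {zero}  c x = sym (*-zeroʳ c)
  sumℚ-*ˡ {suc n} c x =
    trans (cong (c * x zero +_) (sumℚ-*ˡ c (x ∘ suc))) (sym (*-distribˡ-+ c _ _))

  sumℚ-ℕ→ℚ : ∀ {n} (v : Fin n → ℕ) → sumℚ (λ t → ℕ→ℚ (v t)) ≡ ℕ→ℚ (sumℕ v)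
  sumℚ-ℕ→ℚ {zero}  v = refl
  sumℚ-ℕ→ℚ {suc n} v =
    trans (cong (ℕ→ℚ (v zero) +_) (sumℚ-ℕ→ℚ (v ∘ suc))) (sym (ℕ→ℚ-homo-+ (v zero) _))

  sumℚ-const : ∀ n (c : ℚ) → sumℚ {n} (λ _ → c) ≡ ℕ→ℚ n * c
  sumℚ-const zero    c = sym (*-zeroˡ c)
  sumℚ-const (suc n) c = begin
    c + sumℚ {n} (λ _ → c)   ≡⟨ cong₂ _+_ (*-identityˡ c) (sym (sumℚ-const n c)) ⟨
    1ℚ * c + ℕ→ℚ n * c       ≡⟨ *-distribʳ-+ c 1ℚ (ℕ→ℚ n) ⟨
    (1ℚ + ℕ→ℚ n) * c         ≡⟨ cong (_* c) (ℕ→ℚ-homo-+ 1 n) ⟨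
    ℕ→ℚ (suc n) * c          ∎
    where open ≡-Reasoning

  sumℚ-mono-≤ : ∀ {n} {x y : Point n} → (∀ t → x t ≤ y t) → sumℚ x ≤ sumℚ y
  sumℚ-mono-≤ {zero}  x≤y = ≤-refl
  sumℚ-mono-≤ {suc n} x≤y = +-mono-≤ (x≤y zero) (sumℚ-mono-≤ (x≤y ∘ suc))

  sumℚ-mono-< : ∀ {n} {x y : Point n} → (∀ t → x t ≤ y t) → ∀ s → x s < y s → sumℚ x < sumℚ y
  sumℚ-mono-< {suc n} x≤y zero    xs<ys = +-mono-<-≤ xs<ys (sumℚ-mono-≤ (x≤y ∘ suc))
  sumℚ-mono-< {suc n} x≤y (suc s) xs<ys = +-mono-≤-< (x≤y zero) (sumℚ-mono-< (x≤y ∘ suc) s xs<ys)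

  sumℚ-≤-at : ∀ {n} {x : Point n} s → (∀ t → t ≢ s → x t ≤ 0ℚ) → sumℚ x ≤ x s
  sumℚ-≤-at {suc n} {x} zero    others≤0 = begin
    x zero + sumℚ (x ∘ suc)  ≤⟨ +-monoʳ-≤ (x zero) rest≤0 ⟩
    x zero + 0ℚ              ≡⟨ +-identityʳ (x zero) ⟩
    x zero                   ∎
    where
    open ≤-Reasoning
    rest≤0 : sumℚ (x ∘ suc) ≤ 0ℚ
    rest≤0 = begin
      sumℚ (x ∘ suc)           ≤⟨ sumℚ-mono-≤ (λ t → others≤0 (suc t) (λ ())) ⟩
      sumℚ {n} (λ _ → 0ℚ)      ≡⟨ sumℚ-const n 0ℚ ⟩
      ℕ→ℚ n * 0ℚ               ≡⟨ *-zeroʳ (ℕ→ℚ n) ⟩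
      0ℚ                       ∎
  sumℚ-≤-at {suc n} {x} (suc s) others≤0 = begin
    x zero + sumℚ (x ∘ suc)  ≤⟨ +-mono-≤ (others≤0 zero (λ ())) rest≤x[s+1] ⟩
    0ℚ + x (suc s)           ≡⟨ +-identityˡ (x (suc s)) ⟩
    x (suc s)                ∎
    where
    open ≤-Reasoning
    rest≤x[s+1] : sumℚ (x ∘ suc) ≤ x (suc s)
    rest≤x[s+1] = sumℚ-≤-at s (λ t t≢s → others≤0 (suc t) (t≢s ∘ Fin.suc-injective))

  some-coordinate-below : ∀ {n} (x : Point n) c → sumℚ x < ℕ→ℚ n * c → ∃ λ t → x t < c
  some-coordinate-below {n} x c Σx<nc with any? (λ t → x t <? c)
  ... | yes found = found
  ... | no none = contradiction nc≤Σx (<⇒≱ Σx<nc)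
    where
    nc≤Σx : ℕ→ℚ n * c ≤ sumℚ x
    nc≤Σx = subst (_≤ sumℚ x) (sumℚ-const n c) (sumℚ-mono-≤ (λ t → ≮⇒≥ (none ∘ (t ,_))))

  some-other-coordinate-positive : ∀ {n} (x : Point n) s → x s < sumℚ x → ∃ λ t → t ≢ s × 0ℚ < x t
  some-other-coordinate-positive x s xs<Σx with any? (λ t → ¬? (t Fin.≟ s) ×-dec (0ℚ <? x t))
  ... | yes found = found
  ... | no none = contradiction (sumℚ-≤-at s (λ t t≢s → ≮⇒≥ (none ∘ (t ,_) ∘ (t≢s ,_)))) (<⇒≱ xs<Σx)

  record Cell (m : ℕ) (q : ℚ) : Set where
    field
      base      : ℕ
      base≤m    : base ℕ.≤ m
      base≤q    : ℕ→ℚ base ≤ q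
      q≤base+1  : q ≤ ℕ→ℚ base + 1ℚ

  open Cell

  widen : ∀ {m q} → Cell m q → Cell (suc m) q
  widen c = record { Cell c; base≤m = ℕ.m≤n⇒m≤1+n (base≤m c) }

  floor-cell : ∀ m {q} → 0ℚ ≤ q → q < ℕ→ℚ (suc m) → Σ (Cell m q) λ c → q < ℕ→ℚ (base c) + 1ℚ
  floor-cell zero    0≤q q<1 = record { base = 0; base≤m = ℕ.z≤n; base≤q = 0≤q; q≤base+1 = <⇒≤ q<1 } , q<1
  floor-cell (suc m) {q} 0≤q q<m+2 with ℕ→ℚ (suc m) ≤? q
  ... | yes m+1≤q = record { base = suc m; base≤m = ℕ.≤-refl; base≤q = m+1≤q; q≤base+1 = <⇒≤ q<m+2′ } , q<m+2′
    where
    q<m+2′ : q < ℕ→ℚ (suc m) + 1ℚ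
    q<m+2′ = subst (q <_) (ℕ→ℚ-suc (suc m)) q<m+2
  ... | no m+1≰q with floor-cell m 0≤q (≰⇒> m+1≰q)
  ...   | c , q<base+1 = widen c , q<base+1

  ceiling-cell : ∀ m {q} → 0ℚ ≤ q → q ≤ ℕ→ℚ (suc m) → Σ (Cell m q) λ c → 0ℚ < q → ℕ→ℚ (base c) < q
  ceiling-cell zero    0≤q q≤1 = record { base = 0; base≤m = ℕ.z≤n; base≤q = 0≤q; q≤base+1 = q≤1 } , λ 0<q → 0<q
  ceiling-cell (suc m) {q} 0≤q q≤m+2 with q ≤? ℕ→ℚ (suc m)
  ... | yes q≤m+1 with ceiling-cell m 0≤q q≤m+1
  ...   | c , base<q = widen c , base<q
  ceiling-cell (suc m) {q} 0≤q q≤m+2 | no q≰m+1 =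
    record { base = suc m; base≤m = ℕ.≤-refl; base≤q = <⇒≤ (≰⇒> q≰m+1); q≤base+1 = subst (q ≤_) (ℕ→ℚ-suc (suc m)) q≤m+2 }
    , λ _ → ≰⇒> q≰m+1

  1/[1+_] : ℕ → ℚ
  1/[1+ n ] = (1/ ℕ→ℚ (suc n)) {{pos⇒nonZero (ℕ→ℚ (suc n)) {{ℕ→ℚ-suc-pos n}}}}

  *-1/[1+n] : ∀ n → ℕ→ℚ (suc n) * 1/[1+ n ] ≡ 1ℚ
  *-1/[1+n] n = *-inverseʳ (ℕ→ℚ (suc n)) {{pos⇒nonZero (ℕ→ℚ (suc n)) {{ℕ→ℚ-suc-pos n}}}}

  ScaledHypersimplex : (d r i : ℕ) → Point (suc d) → Set
  ScaledHypersimplex d r i x = (sumℚ x ≡ ℕ→ℚ (i ℕ.* r)) × (∀ t → (0ℚ ≤ x t) × (x t ≤ ℕ→ℚ r))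

  dilate⇒scaled : ∀ {d} r {i} {x : Point (suc d)} →
    Dilate r (Hypersimplex d i) x → ScaledHypersimplex d r i x
  dilate⇒scaled r {i} {x} (z , (Σz≡i , z∈[0,1]) , x≡rz) = Σx≡ir , x∈[0,r]
    where
    instance
      r≥0 : NonNegative (ℕ→ℚ r)
      r≥0 = nonNegative (ℕ→ℚ-nonNeg r)
    Σx≡ir : sumℚ x ≡ ℕ→ℚ (i ℕ.* r)
    Σx≡ir = begin
      sumℚ x                     ≡⟨ sumℚ-cong x≡rz ⟩
      sumℚ (λ t → ℕ→ℚ r * z t)   ≡⟨ sumℚ-*ˡ (ℕ→ℚ r) z ⟩
      ℕ→ℚ r * sumℚ z             ≡⟨ cong (ℕ→ℚ r *_) Σz≡i ⟩
      ℕ→ℚ r * ℕ→ℚ i              ≡⟨ *-comm (ℕ→ℚ r) (ℕ→ℚ i) ⟩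
      ℕ→ℚ i * ℕ→ℚ r              ≡⟨ ℕ→ℚ-homo-* i r ⟨
      ℕ→ℚ (i ℕ.* r)              ∎
      where open ≡-Reasoning
    x∈[0,r] : ∀ t → (0ℚ ≤ x t) × (x t ≤ ℕ→ℚ r)
    x∈[0,r] t = subst₂ _≤_ (*-zeroʳ (ℕ→ℚ r)) (sym (x≡rz t)) (*-monoˡ-≤-nonNeg (ℕ→ℚ r) (proj₁ (z∈[0,1] t)))
              , subst₂ _≤_ (sym (x≡rz t)) (*-identityʳ (ℕ→ℚ r)) (*-monoˡ-≤-nonNeg (ℕ→ℚ r) (proj₂ (z∈[0,1] t)))

  scaled⇒dilate : ∀ {d} r {i} {x : Point (suc d)} →
    ScaledHypersimplex d (suc r) i x → Dilate (suc r) (Hypersimplex d i) x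
  scaled⇒dilate r {i} {x} (Σx≡iR , x∈[0,R]) = z , (Σz≡i , z∈[0,1]) , x≡Rz
    where
    R : ℚ
    R = ℕ→ℚ (suc r)
    instance
      R>0 : Positive R
      R>0 = ℕ→ℚ-suc-pos r
    z : Point _
    z t = 1/[1+ r ] * x t
    x≡Rz : ∀ t → x t ≡ R * z t
    x≡Rz t = sym (begin
      R * (1/[1+ r ] * x t)   ≡⟨ *-assoc R 1/[1+ r ] (x t) ⟨
      (R * 1/[1+ r ]) * x t   ≡⟨ cong (_* x t) (*-1/[1+n] r) ⟩
      1ℚ * x t                ≡⟨ *-identityˡ (x t) ⟩
      x t                     ∎)
      where open ≡-Reasoning
    Σz≡i : sumℚ z ≡ ℕ→ℚ i
    Σz≡i = begin
      sumℚ z                       ≡⟨ sumℚ-*ˡ 1/[1+ r ] x ⟩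
      1/[1+ r ] * sumℚ x           ≡⟨ cong (1/[1+ r ] *_) (trans Σx≡iR (ℕ→ℚ-homo-* i (suc r))) ⟩
      1/[1+ r ] * (ℕ→ℚ i * R)      ≡⟨ *-comm 1/[1+ r ] (ℕ→ℚ i * R) ⟩
      (ℕ→ℚ i * R) * 1/[1+ r ]      ≡⟨ *-assoc (ℕ→ℚ i) R 1/[1+ r ] ⟩
      ℕ→ℚ i * (R * 1/[1+ r ])      ≡⟨ cong (ℕ→ℚ i *_) (*-1/[1+n] r) ⟩
      ℕ→ℚ i * 1ℚ                   ≡⟨ *-identityʳ (ℕ→ℚ i) ⟩
      ℕ→ℚ i                        ∎
      where open ≡-Reasoning
    z∈[0,1] : ∀ t → (0ℚ ≤ z t) × (z t ≤ 1ℚ)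
    z∈[0,1] t = *-cancelˡ-≤-pos R (subst₂ _≤_ (sym (*-zeroʳ R)) (x≡Rz t) (proj₁ (x∈[0,R] t)))
              , *-cancelˡ-≤-pos R (subst₂ _≤_ (x≡Rz t) (sym (*-identityʳ R)) (proj₂ (x∈[0,R] t)))

  translate⇒scaled : ∀ {d r i j} {v : Fin (suc d) → ℕ} {x : Point (suc d)} →
    InC r (suc d) (ℤ.+ (i ℕ.* suc r) ℤ.- ℤ.+ j) v → Translate v (Hypersimplex d j) x →
    ScaledHypersimplex d (suc r) i x
  translate⇒scaled {r = r} {i} {j} {v} {x} (Σv≡ir-j , v≤r) (y , (Σy≡j , y∈[0,1]) , x≡v+y) = Σx≡ir , x∈[0,R]
    where
    Σx≡ir : sumℚ x ≡ ℕ→ℚ (i ℕ.* suc r)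
    Σx≡ir = begin
      sumℚ x                              ≡⟨ sumℚ-cong x≡v+y ⟩
      sumℚ (λ t → ℕ→ℚ (v t) + y t)        ≡⟨ sumℚ-+ (λ t → ℕ→ℚ (v t)) y ⟩
      sumℚ (λ t → ℕ→ℚ (v t)) + sumℚ y     ≡⟨ cong₂ _+_ (sumℚ-ℕ→ℚ v) Σy≡j ⟩
      ℕ→ℚ (sumℕ v) + ℕ→ℚ j                ≡⟨ ℕ→ℚ-homo-+ (sumℕ v) j ⟨
      ℕ→ℚ (sumℕ v ℕ.+ j)                  ≡⟨ cong ℕ→ℚ (+m≡+n-+k⇒m+k≡n Σv≡ir-j) ⟩
      ℕ→ℚ (i ℕ.* suc r)                   ∎
      where open ≡-Reasoning
    x∈[0,R] : ∀ t → (0ℚ ≤ x t) × (x t ≤ ℕ→ℚ (suc r))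
    x∈[0,R] t = subst (0ℚ ≤_) (sym (x≡v+y t)) (+-mono-≤ (ℕ→ℚ-nonNeg (v t)) (proj₁ (y∈[0,1] t)))
              , subst₂ _≤_ (sym (x≡v+y t)) (sym (ℕ→ℚ-suc r)) (+-mono-≤ (ℕ→ℚ-mono-≤ (v≤r t)) (proj₂ (y∈[0,1] t)))

  module ScaledToTranslate {d r i} (1≤i : 1 ℕ.≤ i) (i≤d : i ℕ.≤ d) {x : Point (suc d)}
                           (x∈rΔ : ScaledHypersimplex d (suc r) i x) where

    R : ℚ
    R = ℕ→ℚ (suc r)

    Σx≡iR : sumℚ x ≡ ℕ→ℚ (i ℕ.* suc r)
    Σx≡iR = proj₁ x∈rΔ

    x∈[0,R] : ∀ t → (0ℚ ≤ x t) × (x t ≤ R)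
    x∈[0,R] = proj₂ x∈rΔ

    below : ∃ λ t → x t < R
    below = some-coordinate-below x R (begin-strict
      sumℚ x                      ≡⟨ Σx≡iR ⟩
      ℕ→ℚ (i ℕ.* suc r)           <⟨ ℕ→ℚ-mono-< (ℕ.*-monoˡ-< (suc r) (ℕ.s≤s i≤d)) ⟩
      ℕ→ℚ (suc d ℕ.* suc r)       ≡⟨ ℕ→ℚ-homo-* (suc d) (suc r) ⟩
      ℕ→ℚ (suc d) * R             ∎)
      where open ≤-Reasoning

    t₀ : Fin (suc d)
    t₀ = proj₁ below

    positive-elsewhere : ∃ λ t → t ≢ t₀ × 0ℚ < x t
    positive-elsewhere = some-other-coordinate-positive x t₀ (begin-strict
      x t₀                        <⟨ proj₂ below ⟩
      R                           ≤⟨ ℕ→ℚ-mono-≤ (ℕ.m≤n*m (suc r) i {{ℕ.>-nonZero 1≤i}}) ⟩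
      ℕ→ℚ (i ℕ.* suc r)           ≡⟨ Σx≡iR ⟨
      sumℚ x                      ∎)
      where open ≤-Reasoning

    t₁ : Fin (suc d)
    t₁ = proj₁ positive-elsewhere

    cell : ∀ t → Σ (Cell r (x t)) λ c →
      (t ≡ t₀ → x t < ℕ→ℚ (base c) + 1ℚ) × (t ≢ t₀ → 0ℚ < x t → ℕ→ℚ (base c) < x t)
    cell t = round (t Fin.≟ t₀)
      where
      round : Dec (t ≡ t₀) → Σ (Cell r (x t)) λ c →
        (t ≡ t₀ → x t < ℕ→ℚ (base c) + 1ℚ) × (t ≢ t₀ → 0ℚ < x t → ℕ→ℚ (base c) < x t)
      round (yes refl) = map₂ (λ x<base+1 → (λ _ → x<base+1) , (λ t≢t₀ → contradiction refl t≢t₀))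
                              (floor-cell r (proj₁ (x∈[0,R] t)) (proj₂ below))
      round (no t≢t₀) = map₂ (λ base<x → (λ t≡t₀ → contradiction t≡t₀ t≢t₀) , (λ _ → base<x))
                             (ceiling-cell r (proj₁ (x∈[0,R] t)) (proj₂ (x∈[0,R] t)))

    v : Fin (suc d) → ℕ
    v t = base (proj₁ (cell t))

    y : Point (suc d)
    y t = x t - ℕ→ℚ (v t)

    x≡v+y : ∀ t → x t ≡ ℕ→ℚ (v t) + y t
    x≡v+y t = sym (p+[q-p]≡q (ℕ→ℚ (v t)) (x t))

    y∈[0,1] : ∀ t → (0ℚ ≤ y t) × (y t ≤ 1ℚ)
    y∈[0,1] t = p≤q⇒0≤q-p (base≤q (proj₁ (cell t))) , q≤p+r⇒q-p≤r (q≤base+1 (proj₁ (cell t)))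

    Σv+Σy≡iR : ℕ→ℚ (sumℕ v) + sumℚ y ≡ ℕ→ℚ (i ℕ.* suc r)
    Σv+Σy≡iR = begin
      ℕ→ℚ (sumℕ v) + sumℚ y              ≡⟨ cong (_+ sumℚ y) (sumℚ-ℕ→ℚ v) ⟨
      sumℚ (λ t → ℕ→ℚ (v t)) + sumℚ y    ≡⟨ sumℚ-+ (λ t → ℕ→ℚ (v t)) y ⟨
      sumℚ (λ t → ℕ→ℚ (v t) + y t)       ≡⟨ sumℚ-cong x≡v+y ⟨
      sumℚ x                             ≡⟨ Σx≡iR ⟩
      ℕ→ℚ (i ℕ.* suc r)                  ∎
      where open ≡-Reasoning

    0<Σy : 0ℚ < sumℚ y
    0<Σy = begin-strict
      0ℚ                          ≡⟨ *-zeroʳ (ℕ→ℚ (suc d)) ⟨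
      ℕ→ℚ (suc d) * 0ℚ            ≡⟨ sumℚ-const (suc d) 0ℚ ⟨
      sumℚ {suc d} (λ _ → 0ℚ)     <⟨ sumℚ-mono-< (proj₁ ∘ y∈[0,1]) t₁ 0<y[t₁] ⟩
      sumℚ y                      ∎
      where
      open ≤-Reasoning
      0<y[t₁] : 0ℚ < y t₁
      0<y[t₁] = p<q⇒0<q-p (proj₂ (proj₂ (cell t₁)) (proj₁ (proj₂ positive-elsewhere)) (proj₂ (proj₂ positive-elsewhere)))

    Σy<d+1 : sumℚ y < ℕ→ℚ (suc d)
    Σy<d+1 = begin-strict
      sumℚ y                      <⟨ sumℚ-mono-< (proj₂ ∘ y∈[0,1]) t₀ y[t₀]<1 ⟩
      sumℚ {suc d} (λ _ → 1ℚ)     ≡⟨ sumℚ-const (suc d) 1ℚ ⟩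
      ℕ→ℚ (suc d) * 1ℚ            ≡⟨ *-identityʳ (ℕ→ℚ (suc d)) ⟩
      ℕ→ℚ (suc d)                 ∎
      where
      open ≤-Reasoning
      y[t₀]<1 : y t₀ < 1ℚ
      y[t₀]<1 = q<p+r⇒q-p<r (proj₁ (proj₂ (cell t₀)) refl)

    member : Σ ℕ λ j → (1 ℕ.≤ j) × (j ℕ.≤ d) × Σ (Fin (suc d) → ℕ) λ v →
      InC r (suc d) (ℤ.+ (i ℕ.* suc r) ℤ.- ℤ.+ j) v × Translate v (Hypersimplex d j) x
    member =
      let j , Σv+j≡iR , Σy≡j = m+q≡n⇒q∈ℕ (sumℕ v) (i ℕ.* suc r) Σv+Σy≡iR (<⇒≤ 0<Σy)
      in  j , ℕ→ℚ-cancel-< {0} {j} (subst (0ℚ <_) Σy≡j 0<Σy)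
            , ℕ.≤-pred (ℕ→ℚ-cancel-< (subst (_< ℕ→ℚ (suc d)) Σy≡j Σy<d+1))
            , v , (m+k≡n⇒+m≡+n-+k Σv+j≡iR , base≤m ∘ proj₁ ∘ cell)
            , y , (Σy≡j , y∈[0,1]) , x≡v+y

  pushable⇒interior : ∀ {ε c y} → 0ℚ < ε → 0ℚ < c → c < 1ℚ →
    0ℚ ≤ y + ε * (y - c) → y + ε * (y - c) ≤ 1ℚ → (0ℚ < y) × (y < 1ℚ)
  pushable⇒interior {ε} {c} {y} 0<ε 0<c c<1 0≤z z≤1 =
    *-cancelˡ-<-nonNeg k (begin-strict
      k * 0ℚ          ≡⟨ *-zeroʳ k ⟩
      0ℚ              ≡⟨ *-zeroʳ ε ⟨
      ε * 0ℚ          <⟨ *-monoʳ-<-pos ε 0<c ⟩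
      ε * c           ≡⟨ +-identityˡ (ε * c) ⟨
      0ℚ + ε * c      ≤⟨ +-monoˡ-≤ (ε * c) 0≤z ⟩
      z + ε * c       ≡⟨ ky≡z+εc ⟨
      k * y           ∎) ,
    *-cancelˡ-<-nonNeg k (begin-strict
      k * y           ≡⟨ ky≡z+εc ⟩
      z + ε * c       ≤⟨ +-monoˡ-≤ (ε * c) z≤1 ⟩
      1ℚ + ε * c      <⟨ +-monoʳ-< 1ℚ (*-monoʳ-<-pos ε c<1) ⟩
      1ℚ + ε * 1ℚ     ≡⟨ cong (1ℚ +_) (*-identityʳ ε) ⟩
      k               ≡⟨ *-identityʳ k ⟨
      k * 1ℚ          ∎)
    where
    open ≤-Reasoning
    z k : ℚ
    z = y + ε * (y - c)
    k = 1ℚ + ε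
    instance
      ε>0 : Positive ε
      ε>0 = positive 0<ε
      k≥0 : NonNegative k
      k≥0 = nonNegative (<⇒≤ (+-mono-< (positive⁻¹ 1ℚ) 0<ε))
    ky≡z+εc : k * y ≡ z + ε * c
    ky≡z+εc = push-identity y ε c
      where
      push-identity : ∀ y ε c → (1ℚ + ε) * y ≡ (y + ε * (y - c)) + ε * c
      push-identity = solve-∀ ℚ-ring

  barycentre : ∀ {d j} → 1 ℕ.≤ j → j ℕ.≤ d →
    Σ ℚ λ c → (0ℚ < c) × (c < 1ℚ) × Hypersimplex d j (λ _ → c)
  barycentre {d} {j} 1≤j j≤d = c , 0<c , c<1 , trans (sumℚ-const (suc d) c) [d+1]c≡j , λ _ → <⇒≤ 0<c , <⇒≤ c<1
    where
    c : ℚ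
    c = ℕ→ℚ j * 1/[1+ d ]
    instance
      d+1≥0 : NonNegative (ℕ→ℚ (suc d))
      d+1≥0 = nonNegative (ℕ→ℚ-nonNeg (suc d))
    [d+1]c≡j : ℕ→ℚ (suc d) * c ≡ ℕ→ℚ j
    [d+1]c≡j = begin
      ℕ→ℚ (suc d) * (ℕ→ℚ j * 1/[1+ d ])   ≡⟨ *-assoc (ℕ→ℚ (suc d)) (ℕ→ℚ j) 1/[1+ d ] ⟨
      (ℕ→ℚ (suc d) * ℕ→ℚ j) * 1/[1+ d ]   ≡⟨ cong (_* 1/[1+ d ]) (*-comm (ℕ→ℚ (suc d)) (ℕ→ℚ j)) ⟩
      (ℕ→ℚ j * ℕ→ℚ (suc d)) * 1/[1+ d ]   ≡⟨ *-assoc (ℕ→ℚ j) (ℕ→ℚ (suc d)) 1/[1+ d ] ⟩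
      ℕ→ℚ j * (ℕ→ℚ (suc d) * 1/[1+ d ])   ≡⟨ cong (ℕ→ℚ j *_) (*-1/[1+n] d) ⟩
      ℕ→ℚ j * 1ℚ                          ≡⟨ *-identityʳ (ℕ→ℚ j) ⟩
      ℕ→ℚ j                               ∎
      where open ≡-Reasoning
    0<c : 0ℚ < c
    0<c = *-cancelˡ-<-nonNeg (ℕ→ℚ (suc d))
      (subst₂ _<_ (sym (*-zeroʳ (ℕ→ℚ (suc d)))) (sym [d+1]c≡j) (ℕ→ℚ-mono-< {0} 1≤j))
    c<1 : c < 1ℚ
    c<1 = *-cancelˡ-<-nonNeg (ℕ→ℚ (suc d))
      (subst₂ _<_ (sym [d+1]c≡j) (sym (*-identityʳ (ℕ→ℚ (suc d)))) (ℕ→ℚ-mono-< (ℕ.s≤s j≤d)))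

  translated-push : ∀ {a b b′ q ε c} → q ≡ a + b → q + ε * (q - (a + c)) ≡ a + b′ → b′ ≡ b + ε * (b - c)
  translated-push {a} {b} {b′} {q} {ε} {c} q≡a+b pushed≡a+b′ = begin
    b′                                    ≡⟨ p+r-p≡r a b′ ⟨
    a + b′ - a                            ≡⟨ cong (_- a) pushed≡a+b′ ⟨
    q + ε * (q - (a + c)) - a             ≡⟨ cong (λ p → p + ε * (p - (a + c)) - a) q≡a+b ⟩
    a + b + ε * (a + b - (a + c)) - a     ≡⟨ cancel-translation a b ε c ⟩
    b + ε * (b - c)                       ∎
    where
    open ≡-Reasoning
    cancel-translation : ∀ a b e c → a + b + e * (a + b - (a + c)) - a ≡ b + e * (b - c)
    cancel-translation = solve-∀ ℚ-ring

  relint⇒open-cube : ∀ {d j} → 1 ℕ.≤ j → j ℕ.≤ d → ∀ {v} {x : Point (suc d)} →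
    RelInt (Translate v (Hypersimplex d j)) x → ∀ t → (ℕ→ℚ (v t) < x t) × (x t < ℕ→ℚ (v t) + 1ℚ)
  relint⇒open-cube 1≤j j≤d {v} {x} ((y , _ , x≡v+y) , push) t =
    let c , 0<c , c<1 , c∈Δ = barycentre 1≤j j≤d
        ε , 0<ε , y′ , (_ , y′∈[0,1]) , x′≡v+y′ =
          push (λ s → ℕ→ℚ (v s) + c) ((λ _ → c) , c∈Δ , λ _ → refl)
        y′≡ = translated-push {ℕ→ℚ (v t)} {y t} {y′ t} {x t} {ε} {c} (x≡v+y t) (x′≡v+y′ t)
        0<y , y<1 = pushable⇒interior 0<ε 0<c c<1 (subst (0ℚ ≤_) y′≡ (proj₁ (y′∈[0,1] t)))
                                                 (subst (_≤ 1ℚ) y′≡ (proj₂ (y′∈[0,1] t)))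
    in  subst₂ _<_ (+-identityʳ (ℕ→ℚ (v t))) (sym (x≡v+y t)) (+-monoʳ-< (ℕ→ℚ (v t)) 0<y)
      , subst (_< ℕ→ℚ (v t) + 1ℚ) (sym (x≡v+y t)) (+-monoʳ-< (ℕ→ℚ (v t)) y<1)

  a<q<b+1⇒a≤b : ∀ {a b q} → ℕ→ℚ a < q → q < ℕ→ℚ b + 1ℚ → a ℕ.≤ b
  a<q<b+1⇒a≤b {a} {b} {q} a<q q<b+1 =
    ℕ.≤-pred (ℕ→ℚ-cancel-< (<-trans a<q (subst (q <_) (sym (ℕ→ℚ-suc b)) q<b+1)))

  relint-overlap⇒equal : ∀ {d m c j j′ v v′} → 1 ℕ.≤ j → j ℕ.≤ d → 1 ℕ.≤ j′ → j′ ℕ.≤ d →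
    InC m (suc d) (ℤ.+ c ℤ.- ℤ.+ j) v → InC m (suc d) (ℤ.+ c ℤ.- ℤ.+ j′) v′ → ∀ {x} →
    RelInt (Translate v (Hypersimplex d j)) x → RelInt (Translate v′ (Hypersimplex d j′)) x →
    (j ≡ j′) × (∀ t → v t ≡ v′ t)
  relint-overlap⇒equal {c = c} {j} {j′} {v} {v′} 1≤j j≤d 1≤j′ j′≤d (Σv≡c-j , _) (Σv′≡c-j′ , _)
                       {x} x∈ri x∈ri′ = j≡j′ , v≗v′
    where
    cube : ∀ t → (ℕ→ℚ (v t) < x t) × (x t < ℕ→ℚ (v t) + 1ℚ)
    cube = relint⇒open-cube 1≤j j≤d {v} {x} x∈ri
    cube′ : ∀ t → (ℕ→ℚ (v′ t) < x t) × (x t < ℕ→ℚ (v′ t) + 1ℚ)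
    cube′ = relint⇒open-cube 1≤j′ j′≤d {v′} {x} x∈ri′
    v≗v′ : ∀ t → v t ≡ v′ t
    v≗v′ t = ℕ.≤-antisym (a<q<b+1⇒a≤b {v t} {v′ t} (proj₁ (cube t)) (proj₂ (cube′ t)))
                         (a<q<b+1⇒a≤b {v′ t} {v t} (proj₁ (cube′ t)) (proj₂ (cube t)))
    j≡j′ : j ≡ j′
    j≡j′ = ℕ.+-cancelˡ-≡ (sumℕ v) j j′ (begin
      sumℕ v ℕ.+ j     ≡⟨ +m≡+n-+k⇒m+k≡n Σv≡c-j ⟩
      c                ≡⟨ +m≡+n-+k⇒m+k≡n Σv′≡c-j′ ⟨
      sumℕ v′ ℕ.+ j′   ≡⟨ cong (ℕ._+ j′) (sumℕ-cong v≗v′) ⟨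
      sumℕ v ℕ.+ j′    ∎)
      where open ≡-Reasoning

open import Data.Nat using (ℕ; suc; _≤_; _*_; _∸_)
open import Data.Integer using (+_; _-_)
open import Data.Fin using (Fin)
open import Data.Product using (Σ; _×_; _,_)
open import Data.Empty using (⊥)
open import Relation.Nullary using (¬_)
open import Relation.Binary.PropositionalEquality using (_≡_)

theorem1p2 : (d r i : ℕ) → 1 ≤ d → 1 ≤ r → 1 ≤ i → i ≤ d →
    -- union of the members of H_{r,d,i} equals r Δ_{d,i}
    ((x : Point (suc d)) →
      (Dilate r (Hypersimplex d i) x →
        Σ ℕ λ j → (1 ≤ j) × (j ≤ d) × Σ (Fin (suc d) → ℕ) λ v →
          InC (r ∸ 1) (suc d) (+ (i * r) - + j) v × Translate v (Hypersimplex d j) x)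
      × ((j : ℕ) → 1 ≤ j → j ≤ d → (v : Fin (suc d) → ℕ) →
          InC (r ∸ 1) (suc d) (+ (i * r) - + j) v → Translate v (Hypersimplex d j) x →
          Dilate r (Hypersimplex d i) x))
    ×
    -- distinct members have disjoint relative interiors
    ((j j′ : ℕ) → 1 ≤ j → j ≤ d → 1 ≤ j′ → j′ ≤ d →
      (v v′ : Fin (suc d) → ℕ) →
      InC (r ∸ 1) (suc d) (+ (i * r) - + j) v →
      InC (r ∸ 1) (suc d) (+ (i * r) - + j′) v′ →
      ¬ ((j ≡ j′) × ((t : Fin (suc d)) → v t ≡ v′ t)) →
      (x : Point (suc d)) →
      RelInt (Translate v (Hypersimplex d j)) x →
      RelInt (Translate v′ (Hypersimplex d j′)) x → ⊥)
theorem1p2 d 0       i _ () _ _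
theorem1p2 d (suc r) i _ _ 1≤i i≤d =
  (λ x → (λ x∈rΔ → ScaledToTranslate.member 1≤i i≤d (dilate⇒scaled (suc r) {i} x∈rΔ))
       , (λ j _ _ _ v∈C x∈v+Δ → scaled⇒dilate r {i} (translate⇒scaled {i = i} {j} v∈C x∈v+Δ)))
  , λ _ _ 1≤j j≤d 1≤j′ j′≤d _ _ v∈C v′∈C distinct _ x∈ri x∈ri′ →
      distinct (relint-overlap⇒equal 1≤j j≤d 1≤j′ j′≤d v∈C v′∈C x∈ri x∈ri′)
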